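{- Let $c$ be a sorted stable configuration on $K_{m,n}$ and suppose there is a nonempty $A\subseteq\{v_1,\dots,v_{n+m-1}\}$ with $c-\Delta_A$ stable; let $A$ be the $\prec$-minimal such set. Then $v_n\in A$ and $v_{n+m-1}\in A$.
   Context: $K_{m,n}$ has vertices $v_1,\dots,v_{n+m}$, a single edge between $v_i,v_j$ exactly when $i\le n<j$, sink $v_{n+m}$. Configurations are $c\in\mathbb{Z}^{n+m-1}$. $\Delta_i$ is the toppling vector of $v_i$: for $i\le n$, entry $m$ at $i$ and $-1$ at $n+1,\dots,n+m-1$; for $n<i<n+m$, entry $n$ at $i$ and $-1$ at $1,\dots,n$; $\Delta_A=\sum_{v_i\in A}\Delta_i$. $c$ is stable if $0\le c_i\le m-1$ for $i\le n$ and $0\le c_i\le n-1$ for $n<i<n+m$; sorted if $c_1\le\dots\le c_n$ and $c_{n+1}\le\dots\le c_{n+m-1}$. Subsets are ordered by $A\prec B$ if $|A|<|B|$, or $|A|=|B|$ and $A$ is lexicographically smaller (increasing index listing). -}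

module Defs where

open import Data.Nat as Nat using (ℕ; zero; suc; _∸_; _+_)
open import Data.Integer as ℤ using (ℤ; +_; _-_; _≤_; -_)
open import Data.Fin using (Fin; toℕ)
open import Data.Fin.Subset using (Subset; _∈_; ∣_∣; Nonempty)
open import Data.Fin.Subset.Properties using (_∈?_)
open import Data.List using (List; []; _∷_; filter; map; foldr)
open import Data.List.Base using (allFin)
open import Data.Product using (_×_)
open import Data.Sum using (_⊎_)
open import Relation.Binary.PropositionalEquality using (_≡_)
open import Relation.Nullary using (¬_)

-- K_{m,n}: vertices v_1 .. v_{n+m}, sink v_{n+m}.
-- Non-sink vertices v_1 .. v_{n+m-1} are represented by  i : Fin (n + m ∸ 1),
-- where index i stands for v_{toℕ i + 1}.
-- v_{i+1} lies in the first part {v_1..v_n} iff toℕ i < n.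

V : ℕ → ℕ → Set
V n m = Fin (n + m ∸ 1)


Config : ℕ → ℕ → Set
Config n m = V n m → ℤ

IsLeft : (n : ℕ) → {m : ℕ} → V n m → Set
IsLeft n i = toℕ i Nat.< n

IsRight : (n : ℕ) → {m : ℕ} → V n m → Set
IsRight n i = n Nat.≤ toℕ i

Δ : (n m : ℕ) → V n m → V n m → ℤ
Δ n m i j with toℕ i Nat.<? n | toℕ j Nat.<? n
... | Relation.Nullary.yes _ | Relation.Nullary.yes _ with i Data.Fin.≟ j
...   | Relation.Nullary.yes _ = + m
...   | Relation.Nullary.no _  = + 0
Δ n m i j | Relation.Nullary.yes _ | Relation.Nullary.no _ = - (+ 1)
Δ n m i j | Relation.Nullary.no _ | Relation.Nullary.yes _ = - (+ 1)
Δ n m i j | Relation.Nullary.no _ | Relation.Nullary.no _ with i Data.Fin.≟ j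
...   | Relation.Nullary.yes _ = + n
...   | Relation.Nullary.no _  = + 0

ΔSet : (n m : ℕ) → Subset (n + m ∸ 1) → V n m → ℤ
ΔSet n m A j = foldr ℤ._+_ (+ 0) (map (λ i → Δ n m i j) (filter (_∈? A) (allFin _)))

_-Δ_ : {n m : ℕ} → Config n m → Subset (n + m ∸ 1) → Config n m
_-Δ_ {n} {m} c A j = c j - ΔSet n m A j

Stable : (n m : ℕ) → Config n m → Set
Stable n m c = ∀ i → (IsLeft n {m} i → + 0 ≤ c i × c i ≤ + (m ∸ 1))
                   × (IsRight n {m} i → + 0 ≤ c i × c i ≤ + (n ∸ 1))

Sorted : (n m : ℕ) → Config n m → Set
Sorted n m c = ∀ i j → toℕ i Nat.≤ toℕ j →
                 ((IsLeft n {m} i × IsLeft n {m} j) ⊎ (IsRight n {m} i × IsRight n {m} j)) →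
                 c i ≤ c j

listing : {N : ℕ} → Subset N → List ℕ
listing A = map toℕ (filter (_∈? A) (allFin _))

data LexLt : List ℕ → List ℕ → Set where
  here  : ∀ {x y xs ys} → x Nat.< y → LexLt (x ∷ xs) (y ∷ ys)
  there : ∀ {x xs ys} → LexLt xs ys → LexLt (x ∷ xs) (x ∷ ys)
  short : ∀ {y ys} → LexLt [] (y ∷ ys)

_≺_ : {N : ℕ} → Subset N → Subset N → Set
A ≺ B = ∣ A ∣ Nat.< ∣ B ∣ ⊎ (∣ A ∣ ≡ ∣ B ∣ × LexLt (listing A) (listing B))

Admissible : (n m : ℕ) → Config n m → Subset (n + m ∸ 1) → Set
Admissible n m c A = Nonempty A × Stable n m (_-Δ_ {n} {m} c A)

MinAdmissible : (n m : ℕ) → Config n m → Subset (n + m ∸ 1) → Set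
MinAdmissible n m c A = Admissible n m c A × (∀ B → Admissible n m c B → ¬ (B ≺ A))

-- For a vertex v on one side of K_{m,n}, (Δ_A)_v = deg v · [v ∈ A] − r, where r is the
-- number of vertices of A on the other side. If the last vertex t of a side were not in
-- A, then any vertex k of A on that side would give, by stability of c − Δ_A and
-- sortedness, deg v − r ≤ c k ≤ c t ≤ deg v − 1 − r. Such a k exists: A is nonempty, and
-- a vertex of A on the other side keeps c − Δ_A nonnegative only if A has a vertex on
-- this side.
module Submission where

open import Defs
open import Data.Nat using (ℕ; _≤_; _∸_; _+_)
open import Data.Fin using (toℕ)
open import Data.Fin.Subset using (Subset; _∈_)
open import Data.Product using (_×_)
open import Relation.Binary.PropositionalEquality using (_≡_)

open import Data.Bool.Base using (if_then_else_)
open import Data.Empty using (⊥-elim)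
open import Data.Fin using (_≟_)
open import Data.Fin.Properties using (toℕ<n)
open import Data.Fin.Subset.Properties using (_∈?_)
open import Data.Integer.Base as ℤ using (ℤ; +_)
import Data.Integer.Properties as ZP
open import Algebra.Properties.CommutativeSemigroup ZP.+-commutativeSemigroup using (interchange)
open import Algebra.Properties.AbelianGroup ZP.+-0-abelianGroup using (inverseʳ-unique)
open import Data.List.Base using (List; []; _∷_; filter; map; foldr; allFin)
open import Data.List.Membership.Propositional using () renaming (_∈_ to _∈ₗ_; _∉_ to _∉ₗ_)
open import Data.List.Membership.Propositional.Properties using (∈-filter⁺; ∈-filter⁻; ∈-allFin)
open import Data.List.Relation.Unary.Any using (here; there)
open import Data.List.Relation.Unary.AllPairs using (_∷_)
open import Data.List.Relation.Unary.Unique.Propositional using (Unique)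
open import Data.List.Relation.Unary.Unique.Propositional.Properties
  using (allFin⁺; filter⁺; Unique[x∷xs]⇒x∉xs)
open import Data.Nat as ℕ using (_<_; _*_; _<?_)
open import Data.Nat.ListAction using (sum)
import Data.Nat.Properties as NP
open import Data.Product using (_,_; ∃-syntax; proj₁; proj₂)
open import Data.Sum using (_⊎_; inj₁; inj₂)
open import Function using (_∘_)
open import Relation.Binary.Definitions using (DecidableEquality)
open import Relation.Binary.PropositionalEquality using (refl; cong; cong₂; sym; trans; subst; module ≡-Reasoning)
open import Relation.Nullary using (Dec; does; yes; no; ¬_)
open import Relation.Unary using (Pred; Decidable)

𝟙 : ∀ {p} {P : Set p} → Dec P → ℕ
𝟙 d = if does d then 1 else 0

count : ∀ {a p} {A : Set a} {P : Pred A p} → Decidable P → List A → ℕ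
count P? = sum ∘ map (𝟙 ∘ P?)

sumℤ : List ℤ → ℤ
sumℤ = foldr ℤ._+_ (+ 0)

module _ {a p q} {A : Set a} {P : Pred A p} {Q : Pred A q} (P? : Decidable P) (Q? : Decidable Q) where

  sumℤ-map-+-count : (f : A → ℤ) (k : ℕ) → (∀ x → f x ℤ.+ + 𝟙 (P? x) ≡ + (𝟙 (Q? x) * k)) →
                     ∀ xs → sumℤ (map f xs) ℤ.+ + count P? xs ≡ + (count Q? xs * k)
  sumℤ-map-+-count f k f-column [] = refl
  sumℤ-map-+-count f k f-column (x ∷ xs) = begin
    (f x ℤ.+ sumℤ (map f xs)) ℤ.+ (+ 𝟙 (P? x) ℤ.+ + count P? xs)
      ≡⟨ interchange (f x) _ _ _ ⟩
    (f x ℤ.+ + 𝟙 (P? x)) ℤ.+ (sumℤ (map f xs) ℤ.+ + count P? xs)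
      ≡⟨ cong₂ ℤ._+_ (f-column x) (sumℤ-map-+-count f k f-column xs) ⟩
    + (𝟙 (Q? x) * k + count Q? xs * k)
      ≡⟨ cong +_ (sym (NP.*-distribʳ-+ k (𝟙 (Q? x)) (count Q? xs))) ⟩
    + (count Q? (x ∷ xs) * k) ∎
    where open ≡-Reasoning

module _ {a p} {A : Set a} {P : Pred A p} (P? : Decidable P) where

  count>0⇒∃ : ∀ xs → 0 < count P? xs → ∃[ x ] x ∈ₗ xs × P x
  count>0⇒∃ (x ∷ xs) pos with P? x
  ... | yes px = x , here refl , px
  ... | no _ with count>0⇒∃ xs pos
  ...   | y , y∈xs , py = y , there y∈xs , py

module _ {a} {A : Set a} (_≟ₐ_ : DecidableEquality A) where

  count-≟-∉ : ∀ {y xs} → y ∉ₗ xs → count (_≟ₐ y) xs ≡ 0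
  count-≟-∉ {xs = []} y∉ = refl
  count-≟-∉ {y} {x ∷ xs} y∉ with x ≟ₐ y
  ... | yes refl = ⊥-elim (y∉ (here refl))
  ... | no _ = count-≟-∉ (y∉ ∘ there)

  count-≟-∈ : ∀ {y xs} → Unique xs → y ∈ₗ xs → count (_≟ₐ y) xs ≡ 1
  count-≟-∈ {y} uniq@(_ ∷ _) (here refl) with y ≟ₐ y
  ... | yes _ = cong ℕ.suc (count-≟-∉ (Unique[x∷xs]⇒x∉xs uniq))
  ... | no y≢y = ⊥-elim (y≢y refl)
  count-≟-∈ {y} {x ∷ _} uniq@(_ ∷ rest) (there y∈xs) with x ≟ₐ y
  ... | yes refl = ⊥-elim (Unique[x∷xs]⇒x∉xs uniq y∈xs)
  ... | no _ = count-≟-∈ rest y∈xs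

+d≰+[d∸1] : ∀ {d} → 1 ≤ d → ¬ (+ d ℤ.≤ + (d ∸ 1))
+d≰+[d∸1] {ℕ.suc d} _ d+1≤d = NP.1+n≰n (ZP.drop‿+≤+ d+1≤d)

y+x≡d⇒x>0 : ∀ {d x y} → 1 ≤ d → y ℤ.≤ + (d ∸ 1) → y ℤ.+ + x ≡ + d → 0 < x
y+x≡d⇒x>0 {x = ℕ.zero} {y} 1≤d y≤d-1 y+0≡d =
  ⊥-elim (+d≰+[d∸1] 1≤d (subst (ℤ._≤ _) (trans (sym (ZP.+-identityʳ y)) y+0≡d) y≤d-1))
y+x≡d⇒x>0 {x = ℕ.suc _} _ _ _ = ℕ.s≤s ℕ.z≤n

data Side : Set where
  left right : Side

opposite : Side → Side
opposite left = right
opposite right = left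

opposite-involutive : ∀ s → opposite (opposite s) ≡ s
opposite-involutive left = refl
opposite-involutive right = refl

module Bipartite (n m : ℕ) where

  degree : Side → ℕ
  degree left = m
  degree right = n

  On : Side → V n m → Set
  On left = IsLeft n
  On right = IsRight n

  -- Both clauses match on toℕ i <? n, as Δ does, so that Δ-column can compute
  -- Δ and the indicator of the opposite side by the same with-abstraction.
  on? : ∀ s → Decidable (On s)
  on? left i with toℕ i <? n
  ... | yes i<n = yes i<n
  ... | no i≮n = no i≮n
  on? right i with toℕ i <? n
  ... | yes i<n = no (NP.<⇒≱ i<n)
  ... | no i≮n = yes (NP.≮⇒≥ i≮n)

  on-either : ∀ s i → On s i ⊎ On (opposite s) i
  on-either left i with toℕ i <? n
  ... | yes i<n = inj₁ i<n
  ... | no i≮n = inj₂ (NP.≮⇒≥ i≮n)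
  on-either right i with toℕ i <? n
  ... | yes i<n = inj₂ i<n
  ... | no i≮n = inj₁ (NP.≮⇒≥ i≮n)

  Δ-column : ∀ s {j} → On s j → ∀ i →
             Δ n m i j ℤ.+ + 𝟙 (on? (opposite s) i) ≡ + (𝟙 (i ≟ j) * degree s)
  Δ-column left {j} j-on i with toℕ i <? n | toℕ j <? n
  ... | _ | no j≮n = ⊥-elim (j≮n j-on)
  ... | no i≮n | yes j<n with i ≟ j
  ...   | yes refl = ⊥-elim (i≮n j<n)
  ...   | no _ = refl
  Δ-column left {j} j-on i | yes _ | yes _ with i ≟ j
  ...   | yes refl = refl
  ...   | no _ = refl
  Δ-column right {j} j-on i with toℕ i <? n | toℕ j <? n
  ... | _ | yes j<n = ⊥-elim (NP.<⇒≱ j<n j-on)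
  ... | yes i<n | no j≮n with i ≟ j
  ...   | yes refl = ⊥-elim (j≮n i<n)
  ...   | no _ = refl
  Δ-column right {j} j-on i | no _ | no _ with i ≟ j
  ...   | yes refl = refl
  ...   | no _ = refl

  1≤degree : 1 ≤ n → 1 ≤ m → ∀ s → 1 ≤ degree s
  1≤degree _ 1≤m left = 1≤m
  1≤degree 1≤n _ right = 1≤n

  stable-on : ∀ {c} → Stable n m c → ∀ s {i} → On s i → + 0 ℤ.≤ c i × c i ℤ.≤ + (degree s ∸ 1)
  stable-on stable left i-on = proj₁ (stable _) i-on
  stable-on stable right i-on = proj₂ (stable _) i-on

  sorted-on : ∀ {c} → Sorted n m c → ∀ s {i j} → On s i → On s j → toℕ i ≤ toℕ j → c i ℤ.≤ c j
  sorted-on sorted left i-on j-on i≤j = sorted _ _ i≤j (inj₁ (i-on , j-on))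
  sorted-on sorted right i-on j-on i≤j = sorted _ _ i≤j (inj₂ (i-on , j-on))

  elements : Subset (n + m ∸ 1) → List (V n m)
  elements A = filter (_∈? A) (allFin _)

  ΔSet-column : ∀ A s {j} → On s j →
                ΔSet n m A j ℤ.+ + count (on? (opposite s)) (elements A)
                  ≡ + (count (_≟ j) (elements A) * degree s)
  ΔSet-column A s j-on =
    sumℤ-map-+-count (on? (opposite s)) (_≟ _) _ (degree s) (Δ-column s j-on) (elements A)

  ΔSet-column-∈ : ∀ A s {j} → On s j → j ∈ A →
                  ΔSet n m A j ℤ.+ + count (on? (opposite s)) (elements A) ≡ + degree s
  ΔSet-column-∈ A s {j} j-on j∈A = begin
    ΔSet n m A j ℤ.+ + count (on? (opposite s)) (elements A) ≡⟨ ΔSet-column A s j-on ⟩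
    + (count (_≟ j) (elements A) * degree s)                 ≡⟨ cong (λ k → + (k * degree s)) j-once ⟩
    + (1 * degree s)                                          ≡⟨ cong +_ (NP.*-identityˡ (degree s)) ⟩
    + degree s                                                ∎
    where
    open ≡-Reasoning
    j-once : count (_≟ j) (elements A) ≡ 1
    j-once = count-≟-∈ _≟_ (filter⁺ (_∈? A) (allFin⁺ _)) (∈-filter⁺ (_∈? A) (∈-allFin j) j∈A)

  ΔSet-column-∉ : ∀ A s {j} → On s j → ¬ j ∈ A →
                  ΔSet n m A j ℤ.+ + count (on? (opposite s)) (elements A) ≡ + 0
  ΔSet-column-∉ A s {j} j-on j∉A = trans (ΔSet-column A s j-on) (cong (λ k → + (k * degree s)) j-never)
    where
    j-never : count (_≟ j) (elements A) ≡ 0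
    j-never = count-≟-∉ _≟_ (j∉A ∘ proj₂ ∘ ∈-filter⁻ (_∈? A) {xs = allFin _})

  module _ (1≤n : 1 ≤ n) (1≤m : 1 ≤ m) {c : Config n m} (sorted : Sorted n m c) (stable : Stable n m c)
           {A : Subset (n + m ∸ 1)} (admissible : Admissible n m c A) where

    ΔSet≤c : ∀ s {j} → On s j → ΔSet n m A j ℤ.≤ c j
    ΔSet≤c s j-on = ZP.0≤i-j⇒j≤i (proj₁ (stable-on (proj₂ admissible) s j-on))

    c-ΔSet≤d-1 : ∀ s {j} → On s j → c j ℤ.- ΔSet n m A j ℤ.≤ + (degree s ∸ 1)
    c-ΔSet≤d-1 s j-on = proj₂ (stable-on (proj₂ admissible) s j-on)

    meets-opposite : ∀ s {k} → k ∈ A → On s k → ∃[ j ] j ∈ A × On (opposite s) j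
    meets-opposite s {k} k∈A k-on =
      let j , j∈elements , j-on = count>0⇒∃ (on? (opposite s)) (elements A) opposite-count>0
      in j , proj₂ (∈-filter⁻ (_∈? A) {xs = allFin _} j∈elements) , j-on
      where
      opposite-count>0 : 0 < count (on? (opposite s)) (elements A)
      opposite-count>0 = y+x≡d⇒x>0 (1≤degree 1≤n 1≤m s)
                           (ZP.≤-trans (ΔSet≤c s k-on) (proj₂ (stable-on stable s k-on)))
                           (ΔSet-column-∈ A s k-on k∈A)

    meets : ∀ s → ∃[ j ] j ∈ A × On s j
    meets s with proj₁ admissible
    ... | k , k∈A with on-either s k
    ...   | inj₁ k-on = k , k∈A , k-on
    ...   | inj₂ k-on = subst (λ s′ → ∃[ j ] j ∈ A × On s′ j) (opposite-involutive s)
                          (meets-opposite (opposite s) k∈A k-on)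

    last-∈ : ∀ s {t} → On s t → (∀ {k} → On s k → toℕ k ≤ toℕ t) → t ∈ A
    last-∈ s {t} t-on t-last with t ∈? A
    ... | yes t∈A = t∈A
    ... | no t∉A with meets s
    ...   | k , k∈A , k-on = ⊥-elim (+d≰+[d∸1] (1≤degree 1≤n 1≤m s) (begin
      + degree s                  ≡⟨ sym (ΔSet-column-∈ A s k-on k∈A) ⟩
      ΔSet n m A k ℤ.+ r          ≤⟨ ZP.+-monoˡ-≤ r (ΔSet≤c s k-on) ⟩
      c k ℤ.+ r                   ≤⟨ ZP.+-monoˡ-≤ r (sorted-on sorted s k-on t-on (t-last k-on)) ⟩
      c t ℤ.+ r                   ≡⟨ cong (ℤ._+_ (c t)) r≡-Δt ⟩
      c t ℤ.- ΔSet n m A t        ≤⟨ c-ΔSet≤d-1 s t-on ⟩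
      + (degree s ∸ 1)            ∎))
      where
      open ZP.≤-Reasoning
      r : ℤ
      r = + count (on? (opposite s)) (elements A)
      r≡-Δt : r ≡ ℤ.- ΔSet n m A t
      r≡-Δt = inverseʳ-unique _ r (ΔSet-column-∉ A s t-on t∉A)

lemma4p4 : (n m : ℕ) → 1 ≤ n → 1 ≤ m → (c : Config n m) → Sorted n m c → Stable n m c →
    (A : Subset (n + m ∸ 1)) → MinAdmissible n m c A →
    (∀ i → toℕ i ≡ n ∸ 1 → i ∈ A) × (∀ i → toℕ i ≡ n + m ∸ 2 → i ∈ A)
lemma4p4 n m 1≤n 1≤m c sorted stable A (admissible , _) = last-left-∈ , last-right-∈
  where
  open Bipartite n m

  last-of-side-∈ : ∀ s {t} → On s t → (∀ {k} → On s k → toℕ k ≤ toℕ t) → t ∈ A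
  last-of-side-∈ = last-∈ 1≤n 1≤m sorted stable admissible

  last-left-∈ : ∀ i → toℕ i ≡ n ∸ 1 → i ∈ A
  last-left-∈ i i≡n-1 = last-of-side-∈ left (subst (_< n) (sym i≡n-1) (NP.∸-monoʳ-< (ℕ.s≤s ℕ.z≤n) 1≤n))
                          (λ k-on → subst (_ ≤_) (sym i≡n-1) (NP.<⇒≤pred k-on))

  index-≤-last : ∀ {i k : V n m} → toℕ i ≡ n + m ∸ 2 → toℕ k ≤ toℕ i
  index-≤-last {k = k} i≡n+m-2 =
    subst (toℕ k ≤_) (trans (NP.∸-+-assoc (n + m) 1 1) (sym i≡n+m-2)) (NP.<⇒≤pred (toℕ<n k))

  last-right-∈ : ∀ i → toℕ i ≡ n + m ∸ 2 → i ∈ A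
  -- for m = 1 the last non-sink vertex is v_n, on the left side
  last-right-∈ i i≡n+m-2 with on-either right i
  ... | inj₁ i-right = last-of-side-∈ right i-right (λ _ → index-≤-last i≡n+m-2)
  ... | inj₂ i-left = last-of-side-∈ left i-left (λ _ → index-≤-last i≡n+m-2)
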